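{- There exists an $O(D)$-round deterministic algorithm in the CONGEST model that, given a graph $G=(V,E)$ and a clique edge cover $Q$ of $G$ with diversity $D$ (each node knowing the cliques containing it), computes a set of nodes $P\subseteq V$ such that (small degree) $|P\cap C|\leq D$ for every clique $C\in Q$, and (domination) for every node $v\in V$ there is a node $p\in P$ with $\mathrm{dist}_G(v,p)\leq D$. Moreover, $P$ is a $(D^2,D)$-vertex-kernel of $G$.
   Context: CONGEST model: the network is an $n$-node graph $G=(V,E)$; each node has a unique $O(\log n)$-bit ID; in each synchronous round every node may send a message of $O(\log n)$ bits to each neighbor and perform unbounded local computation. A clique edge cover of $G$ is a collection $Q$ of cliques of $G$ such that every node lies in some clique of $Q$ and every edge $\{u,v\}\in E$ has both endpoints in some clique of $Q$; its diversity is $\max_{v\in V}|\{C\in Q: v\in C\}|$. For $A\subseteq V$, $G[A]$ is the induced subgraph. A $(d,r)$-vertex-kernel of $G$ is a set $A\subseteq V$ such that $G[A]$ has maximum degree at most $d$ and every $v\in V$ has some $u\in A$ with $\mathrm{dist}_G(v,u)\leq r$. -}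

module Defs where

open import Data.Nat using (ℕ; zero; suc; _+_; _*_; _≤_; _<_; _⊔_; _^_; _≡ᵇ_)
open import Data.Nat.Logarithm using (⌈log₂_⌉)
open import Data.Bool using (Bool; true; false; _∧_; if_then_else_)
open import Data.Fin using (Fin; zero; suc)
open import Data.Fin.Subset using (Subset; _∈_; ∣_∣; _∩_)
open import Data.Vec using (lookup; tabulate)
open import Data.List using (List; []; _∷_; length; map; filterᵇ)
open import Data.List.Relation.Unary.All using (All)
open import Data.List.Relation.Unary.Any using (Any)
open import Data.Maybe using (Maybe; just; nothing; maybe)
open import Data.Product using (Σ; ∃; _×_)
open import Function using (_∘_)
open import Relation.Binary.PropositionalEquality using (_≡_; _≢_)

record Graph (n : ℕ) : Set where
  field
    adj    : Fin n → Fin n → Bool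
    sym    : ∀ u v → adj u v ≡ adj v u
    irrefl : ∀ v → adj v v ≡ false
open Graph public

nbhd : ∀ {n} → Graph n → Fin n → Subset n
nbhd G v = tabulate (adj G v)

data WithinDist {n} (G : Graph n) : ℕ → Fin n → Fin n → Set where
  here : ∀ {k v} → WithinDist G k v v
  step : ∀ {k u w v} → adj G u w ≡ true → WithinDist G k w v → WithinDist G (suc k) u v

findFin : ∀ {n} → (Fin n → Bool) → Maybe (Fin n)
findFin {zero}  p = nothing
findFin {suc n} p = if p zero then just zero else Data.Maybe.map suc (findFin (p ∘ suc))

anyFin : ∀ {n} → (Fin n → Bool) → Bool
anyFin p = maybe (λ _ → true) false (findFin p)

maxFin : ∀ {n} → (Fin n → ℕ) → ℕ
maxFin {zero}  f = 0
maxFin {suc n} f = f zero ⊔ maxFin (f ∘ suc)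

IsClique : ∀ {n} → Graph n → Subset n → Set
IsClique G C = ∀ u v → u ∈ C → v ∈ C → u ≢ v → adj G u v ≡ true

IsCliqueEdgeCover : ∀ {n} → Graph n → List (Subset n) → Set
IsCliqueEdgeCover G Q =
    All (IsClique G) Q
  × (∀ v → Any (v ∈_) Q)
  × (∀ u v → adj G u v ≡ true → Any (λ C → u ∈ C × v ∈ C) Q)

cliquesOf : ∀ {n} → List (Subset n) → Fin n → List (Subset n)
cliquesOf Q v = filterᵇ (λ C → lookup C v) Q

diversity : ∀ {n} → List (Subset n) → ℕ
diversity Q = maxFin (λ v → length (cliquesOf Q v))

IsVertexKernel : ∀ {n} → Graph n → ℕ → ℕ → Subset n → Set
IsVertexKernel G d r A =
    (∀ v → v ∈ A → ∣ A ∩ nbhd G v ∣ ≤ d)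
  × (∀ v → ∃ λ u → u ∈ A × WithinDist G r v u)

Msg : Set
Msg = List Bool

record Algorithm : Set₁ where
  field
    State  : Set
    -- initial local knowledge: n, D, own ID, which IDs are neighbours,
    -- and the cliques containing the node (each as a membership predicate on IDs)
    init   : (n D myId : ℕ) (isNbr : ℕ → Bool) (myCliques : List (ℕ → Bool)) → State
    -- message sent to the neighbour with the given ID (nothing = no message)
    send   : State → ℕ → Maybe Msg
    -- local transition given the inbox (sender ID ↦ message)
    trans  : State → (ℕ → Maybe Msg) → State
    -- nothing = still running; just b = decided (b = true : node joins P)
    output : State → Maybe Bool
open Algorithm public

module Run (A : Algorithm) {n : ℕ} (G : Graph n) (Q : List (Subset n)) (ids : Fin n → ℕ) where

  idOf : Subset n → ℕ → Bool
  idOf S x = anyFin (λ u → lookup S u ∧ (ids u ≡ᵇ x))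

  isNbrOf : Fin n → ℕ → Bool
  isNbrOf v = idOf (nbhd G v)

  run : ℕ → Fin n → State A
  run zero    v = init A n (diversity Q) (ids v) (isNbrOf v) (map idOf (cliquesOf Q v))
  run (suc t) v = trans A (run t v)
    (λ x → maybe (λ u → send A (run t u) (ids v)) nothing
                 (findFin (λ u → adj G u v ∧ (ids u ≡ᵇ x))))

-- a message has at most B·(1 + ⌈log₂ (n+1)⌉) bits, i.e. O(log n)
MsgBounded : ℕ → ℕ → Maybe Msg → Set
MsgBounded B n m = ∀ bs → m ≡ just bs → length bs ≤ B * suc ⌈log₂ (suc n)⌉

module Submission where

-- Every node starts active. In each of D rounds every clique C of the cover chooses
-- its least active member not chosen in C before; this is a local decision, since the
-- members of C are pairwise adjacent and hear each other's activity bit. The nodes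
-- chosen somewhere form the active set of the next round, and P consists of the nodes
-- chosen in every clique containing them.
-- A clique chooses at most one node per round, so |P ∩ C| ≤ D; as N(v) is covered by
-- the at most D cliques containing v, |P ∩ N(v)| ≤ D². A node active in round j has
-- been chosen in at least j of its cliques, hence a node active after D rounds is in P.
-- An active node x not yet chosen in all its cliques is a candidate in one of them, which
-- therefore chooses a node adjacent or equal to x, active in the next round; following
-- such steps from v reaches, within D hops, a node that is active after D rounds or
-- already in P.

open import Defs
open import Data.Bool using (Bool; true; false; T; not; _∧_; _∨_; if_then_else_)
open import Data.Bool.Properties using (T-≡; T-∧; T-∨)
open import Data.Bool.ListAction using (and; or; all; any)
open import Data.Empty using (⊥-elim)
open import Data.Fin using (Fin; zero; suc; toℕ; fromℕ<)
import Data.Fin.Properties as Fin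
open import Data.Fin.Subset using (Subset; _∈_; ∣_∣; _∩_; _∪_; _⊆_; ⋃)
open import Data.Fin.Subset.Properties
  using (p⊆q⇒∣p∣≤∣q∣; ∣⊥∣≡0; Empty-unique; x∈p∪q⁺; x∈p∩q⁺; x∈p∩q⁻)
open import Data.List using (List; []; _∷_; length; map; filterᵇ)
open import Data.List.Properties using (length-filter; filter-complete; map-∘; map-cong-local)
open import Data.List.Membership.Propositional using (find; lose) renaming (_∈_ to _∈ᴸ_)
open import Data.List.Membership.Propositional.Properties using (∈-filter⁺; ∈-filter⁻)
open import Data.List.Relation.Unary.All as All using (All; []; _∷_)
open import Data.List.Relation.Unary.All.Properties using (all⁺; all⁻; all-filter; ¬All⇒Any¬)
open import Data.List.Relation.Unary.Any using (here; there)
open import Data.List.Relation.Unary.Any.Properties using (any⁺; any⁻)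
open import Data.List.Relation.Unary.Unique.Propositional using (Unique)
open import Data.Maybe as Maybe using (Maybe; just; nothing; maybe)
open import Data.Nat using (ℕ; zero; suc; _+_; _*_; _∸_; _≤_; _<_; _^_; _≡ᵇ_; _<ᵇ_; z≤n; s≤s)
open import Data.Nat.Properties
open import Data.Product using (Σ; ∃; _×_; _,_; proj₁; proj₂)
open import Data.Sum as Sum using (_⊎_; inj₁; inj₂)
open import Data.Unit using (tt)
open import Data.Vec using ([]; _∷_; here; there; lookup; tabulate)
open import Data.Vec.Properties using (lookup⇒[]=; []=⇒lookup; lookup∘tabulate)
open import Function using (_∘_; id)
open import Function.Bundles using (module Equivalence)
open import Function.Definitions using (Injective)
open import Relation.Binary.PropositionalEquality
  using (_≡_; _≢_; refl; cong; cong₂; subst; _≗_; module ≡-Reasoning)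
  renaming (sym to ≡-sym; trans to ≡-trans)
open import Relation.Nullary using (¬_; yes; no)
open import Relation.Nullary.Decidable using (T?)

open Equivalence using (to; from)

T-not⁺ : ∀ {b} → ¬ T b → T (not b)
T-not⁺ {false} _  = tt
T-not⁺ {true}  ¬t = ¬t tt

T-not⁻ : ∀ {b} → T (not b) → ¬ T b
T-not⁻ {false} _ ()

findFin-sound : ∀ {n} (p : Fin n → Bool) {i} → findFin p ≡ just i → T (p i)
findFin-sound {suc n} p e with p zero in p0
findFin-sound {suc n} p refl | true = from T-≡ p0
... | false with findFin (p ∘ suc) in found
findFin-sound {suc n} p refl | false | just i = findFin-sound (p ∘ suc) found

findFin-complete : ∀ {n} (p : Fin n → Bool) i → T (p i) → ∃ λ j → findFin p ≡ just j
findFin-complete {suc n} p i pi with p zero in p0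
... | true = zero , refl
findFin-complete {suc n} p zero    pi | false = ⊥-elim (subst T p0 pi)
findFin-complete {suc n} p (suc i) pi | false with findFin-complete (p ∘ suc) i pi
... | j , found = suc j , cong (Maybe.map suc) found

findFin-cong : ∀ {n} {p q : Fin n → Bool} → p ≗ q → findFin p ≡ findFin q
findFin-cong {zero}          p≗q = refl
findFin-cong {suc n} {p} {q} p≗q
  rewrite p≗q zero | findFin-cong {p = p ∘ suc} {q ∘ suc} (p≗q ∘ suc) = refl

anyFin⁺ : ∀ {n} (p : Fin n → Bool) i → T (p i) → T (anyFin p)
anyFin⁺ p i pi with findFin-complete p i pi
... | _ , found rewrite found = tt

anyFin⁻ : ∀ {n} (p : Fin n → Bool) → T (anyFin p) → ∃ λ i → T (p i)
anyFin⁻ p h with findFin p in found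
... | just i  = i , findFin-sound p found
... | nothing = ⊥-elim h

firstBelow : ℕ → (ℕ → Bool) → Maybe ℕ
firstBelow N p = Maybe.map toℕ (findFin {N} (p ∘ toℕ))

firstBelow-sound : ∀ N (p : ℕ → Bool) {x} → firstBelow N p ≡ just x → T (p x)
firstBelow-sound N p e with findFin {N} (p ∘ toℕ) in found
firstBelow-sound N p refl | just i = findFin-sound (p ∘ toℕ) found

firstBelow-complete : ∀ N (p : ℕ → Bool) {y} → y < N → T (p y) → ∃ λ x → firstBelow N p ≡ just x
firstBelow-complete N p y<N py
  with findFin-complete (p ∘ toℕ) (fromℕ< y<N) (subst (T ∘ p) (≡-sym (Fin.toℕ-fromℕ< y<N)) py)
... | i , found = toℕ i , cong (Maybe.map toℕ) found

firstBelow-cong : ∀ N {p q : ℕ → Bool} → p ≗ q → firstBelow N p ≡ firstBelow N q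
firstBelow-cong N p≗q = cong (Maybe.map toℕ) (findFin-cong {N} (p≗q ∘ toℕ))

module _ {A : Set} {f g : A → Bool} (f⇒g : ∀ x → T (f x) → T (g x)) where

  length-filterᵇ-mono : ∀ xs → length (filterᵇ f xs) ≤ length (filterᵇ g xs)
  length-filterᵇ-mono [] = z≤n
  length-filterᵇ-mono (x ∷ xs) with ih ← length-filterᵇ-mono xs | f x in fx | g x in gx
  ... | true  | true  = s≤s ih
  ... | true  | false = ⊥-elim (subst T gx (f⇒g x (from T-≡ fx)))
  ... | false | true  = m≤n⇒m≤1+n ih
  ... | false | false = ih

  length-filterᵇ-< : ∀ {c xs} → c ∈ᴸ xs → ¬ T (f c) → T (g c) →
                     length (filterᵇ f xs) < length (filterᵇ g xs)
  length-filterᵇ-< {c} {_ ∷ xs} (here refl) ¬fc gc with f c | g c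
  ... | true  | _     = ⊥-elim (¬fc tt)
  ... | false | true  = s≤s (length-filterᵇ-mono xs)
  length-filterᵇ-< {c} {x ∷ xs} (there c∈xs) ¬fc gc
    with ih ← length-filterᵇ-< c∈xs ¬fc gc | f x in fx | g x in gx
  ... | true  | true  = s≤s ih
  ... | true  | false = ⊥-elim (subst T gx (f⇒g x (from T-≡ fx)))
  ... | false | true  = m<n⇒m<1+n ih
  ... | false | false = ih

length≤length-filterᵇ⇒all : ∀ {A : Set} (g : A → Bool) xs → length xs ≤ length (filterᵇ g xs) → T (all g xs)
length≤length-filterᵇ⇒all g xs le = all⁻ g (subst (All (T ∘ g)) filterᵇ≡xs (all-filter (T? ∘ g) xs))
  where
  filterᵇ≡xs : filterᵇ g xs ≡ xs
  filterᵇ≡xs = filter-complete (T? ∘ g) (≤-antisym (length-filter (T? ∘ g) xs) le)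

any-filterᵇ : ∀ {A : Set} {f g : A → Bool} → (∀ x → T (g x) → T (f x)) →
              ∀ xs → any g (filterᵇ f xs) ≡ any g xs
any-filterᵇ g⇒f [] = refl
any-filterᵇ {f = f} {g} g⇒f (x ∷ xs) with ih ← any-filterᵇ g⇒f xs | f x in fx
... | true = cong (g x ∨_) ih
... | false with g x in gx
...   | false = ih
...   | true  = ⊥-elim (subst T fx (g⇒f x (from T-≡ gx)))

∈⇒T-lookup : ∀ {n} {p : Subset n} {x} → x ∈ p → T (lookup p x)
∈⇒T-lookup x∈p = from T-≡ ([]=⇒lookup x∈p)

T-lookup⇒∈ : ∀ {n} {p : Subset n} {x} → T (lookup p x) → x ∈ p
T-lookup⇒∈ {p = p} {x} h = lookup⇒[]= x p (to T-≡ h)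

∈-tabulate⁺ : ∀ {n} (f : Fin n → Bool) {x} → T (f x) → x ∈ tabulate f
∈-tabulate⁺ f {x} fx = T-lookup⇒∈ (subst T (≡-sym (lookup∘tabulate f x)) fx)

∈-tabulate⁻ : ∀ {n} (f : Fin n → Bool) {x} → x ∈ tabulate f → T (f x)
∈-tabulate⁻ f {x} x∈ = subst T (lookup∘tabulate f x) (∈⇒T-lookup x∈)

∣p∪q∣≤∣p∣+∣q∣ : ∀ {n} (p q : Subset n) → ∣ p ∪ q ∣ ≤ ∣ p ∣ + ∣ q ∣
∣p∪q∣≤∣p∣+∣q∣ []          []          = z≤n
∣p∪q∣≤∣p∣+∣q∣ (true  ∷ p) (true  ∷ q) = s≤s (≤-trans (∣p∪q∣≤∣p∣+∣q∣ p q) (+-monoʳ-≤ ∣ p ∣ (n≤1+n _)))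
∣p∪q∣≤∣p∣+∣q∣ (true  ∷ p) (false ∷ q) = s≤s (∣p∪q∣≤∣p∣+∣q∣ p q)
∣p∪q∣≤∣p∣+∣q∣ (false ∷ p) (true  ∷ q) = ≤-trans (s≤s (∣p∪q∣≤∣p∣+∣q∣ p q)) (≤-reflexive (≡-sym (+-suc _ _)))
∣p∪q∣≤∣p∣+∣q∣ (false ∷ p) (false ∷ q) = ∣p∪q∣≤∣p∣+∣q∣ p q

∈⋃-map⁺ : ∀ {n} {A : Set} (f : A → Subset n) {x xs u} → x ∈ᴸ xs → u ∈ f x → u ∈ ⋃ (map f xs)
∈⋃-map⁺ f (here refl) u∈ = x∈p∪q⁺ (inj₁ u∈)
∈⋃-map⁺ f (there x∈)  u∈ = x∈p∪q⁺ (inj₂ (∈⋃-map⁺ f x∈ u∈))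

∣⋃-map∣≤ : ∀ {n d} {A : Set} (f : A → Subset n) xs → (∀ {x} → x ∈ᴸ xs → ∣ f x ∣ ≤ d) →
           ∣ ⋃ (map f xs) ∣ ≤ length xs * d
∣⋃-map∣≤ {n} f [] _ = ≤-reflexive (∣⊥∣≡0 n)
∣⋃-map∣≤ f (x ∷ xs) bound = ≤-trans (∣p∪q∣≤∣p∣+∣q∣ (f x) (⋃ (map f xs)))
                                    (+-mono-≤ (bound (here refl)) (∣⋃-map∣≤ f xs (bound ∘ there)))

∣p∣≤1 : ∀ {n} (p : Subset n) → (∀ {x y} → x ∈ p → y ∈ p → x ≡ y) → ∣ p ∣ ≤ 1
∣p∣≤1         []          _      = z≤n
∣p∣≤1         (false ∷ p) unique = ∣p∣≤1 p (λ x∈ y∈ → Fin.suc-injective (unique (there x∈) (there y∈)))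
∣p∣≤1 {suc n} (true  ∷ p) unique =
  s≤s (≤-reflexive (≡-trans (cong ∣_∣ (Empty-unique λ (x , x∈) → Fin.0≢1+n (unique here (there x∈)))) (∣⊥∣≡0 n)))

_∈ᵇ_ : ℕ → List ℕ → Bool
x ∈ᵇ ys = any (x ≡ᵇ_) ys

∣preimage∣≤length : ∀ {n} {f : Fin n → ℕ} → Injective _≡_ _≡_ f →
                    ∀ ys → ∣ tabulate (λ u → f u ∈ᵇ ys) ∣ ≤ length ys
∣preimage∣≤length {n} inj [] =
  ≤-reflexive (≡-trans (cong ∣_∣ (Empty-unique {n} λ (_ , u∈) → ∈-tabulate⁻ _ u∈)) (∣⊥∣≡0 n))
∣preimage∣≤length {f = f} inj (y ∷ ys) = begin
  ∣ tabulate (λ u → f u ∈ᵇ (y ∷ ys)) ∣ ≤⟨ p⊆q⇒∣p∣≤∣q∣ split ⟩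
  ∣ fiber ∪ preimage ∣                  ≤⟨ ∣p∪q∣≤∣p∣+∣q∣ fiber preimage ⟩
  ∣ fiber ∣ + ∣ preimage ∣              ≤⟨ +-mono-≤ (∣p∣≤1 fiber fiber-unique) (∣preimage∣≤length inj ys) ⟩
  1 + length ys                         ∎
  where
  open ≤-Reasoning
  fiber preimage : Subset _
  fiber    = tabulate (λ u → f u ≡ᵇ y)
  preimage = tabulate (λ u → f u ∈ᵇ ys)
  split : tabulate (λ u → f u ∈ᵇ (y ∷ ys)) ⊆ fiber ∪ preimage
  split u∈ = x∈p∪q⁺ (Sum.map (∈-tabulate⁺ _) (∈-tabulate⁺ _) (to T-∨ (∈-tabulate⁻ _ u∈)))
  fiber-unique : ∀ {u w} → u ∈ fiber → w ∈ fiber → u ≡ w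
  fiber-unique u∈ w∈ = inj (≡-trans (≡ᵇ⇒≡ _ _ (∈-tabulate⁻ _ u∈)) (≡-sym (≡ᵇ⇒≡ _ _ (∈-tabulate⁻ _ w∈))))

module _ {n} {G : Graph n} where

  WithinDist-suc : ∀ {j u v} → WithinDist G j u v → WithinDist G (suc j) u v
  WithinDist-suc here         = here
  WithinDist-suc (step e walk) = step e (WithinDist-suc walk)

  WithinDist-snoc : ∀ {j u v w} → WithinDist G j u v → adj G v w ≡ true → WithinDist G (suc j) u w
  WithinDist-snoc here          e = step e here
  WithinDist-snoc (step e′ walk) e = step e′ (WithinDist-snoc walk e)

f≤maxFin : ∀ {n} (f : Fin n → ℕ) i → f i ≤ maxFin f
f≤maxFin f zero    = m≤m⊔n _ _
f≤maxFin f (suc i) = ≤-trans (f≤maxFin (f ∘ suc) i) (m≤n⊔m _ _)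

module SelectionRule (N : ℕ) (active member : ℕ → Bool) (chosen : List ℕ) where

  candidate : ℕ → Bool
  candidate x = member x ∧ (not (x ∈ᵇ chosen) ∧ active x)

  pick : Maybe ℕ
  pick = firstBelow N candidate

  addPick : List ℕ
  addPick = maybe (_∷ chosen) chosen pick

  picks : ℕ → Bool
  picks x = maybe (_≡ᵇ x) false pick

  pick-sound : ∀ {x} → pick ≡ just x →
               T (member x) × ¬ T (x ∈ᵇ chosen) × T (active x)
  pick-sound {x} picked with to (T-∧ {member x}) (firstBelow-sound N candidate picked)
  ... | mx , rest with to (T-∧ {not (x ∈ᵇ chosen)}) rest
  ...   | fresh , ax = mx , T-not⁻ fresh , ax

  pick-complete : ∀ {y} → y < N → T (member y) → ¬ T (y ∈ᵇ chosen) → T (active y) →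
                  ∃ λ x → pick ≡ just x
  pick-complete y<N my fresh ay = firstBelow-complete N candidate y<N (from T-∧ (my , from T-∧ (T-not⁺ fresh , ay)))

  picks⇒pick : ∀ {x} → T (picks x) → pick ≡ just x
  picks⇒pick h with pick
  ... | just y  = cong just (≡ᵇ⇒≡ y _ h)
  ... | nothing = ⊥-elim h

  pick⇒picks : ∀ {x} → pick ≡ just x → T (picks x)
  pick⇒picks {x} picked rewrite picked = ≡⇒≡ᵇ x x refl

  pick⇒∈addPick : ∀ {x} → pick ≡ just x → T (x ∈ᵇ addPick)
  pick⇒∈addPick {x} picked rewrite picked = from T-∨ (inj₁ (≡⇒≡ᵇ x x refl))

  ∈-addPick : ∀ {y} → T (y ∈ᵇ chosen) → T (y ∈ᵇ addPick)
  ∈-addPick h with pick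
  ... | just _  = from T-∨ (inj₂ h)
  ... | nothing = h

  length-addPick : length addPick ≤ suc (length chosen)
  length-addPick with pick
  ... | just _  = ≤-refl
  ... | nothing = n≤1+n _

open SelectionRule using (candidate; pick; addPick; picks)

pick-cong : ∀ N {a b member : ℕ → Bool} chosen → (∀ x → T (member x) → a x ≡ b x) →
            pick N a member chosen ≡ pick N b member chosen
pick-cong N {a} {b} {member} chosen a≈b = firstBelow-cong N candidate≗
  where
  candidate≗ : candidate N a member chosen ≗ candidate N b member chosen
  candidate≗ x with member x in mx
  ... | false = refl
  ... | true  = cong (not (x ∈ᵇ chosen) ∧_) (a≈b x (from T-≡ mx))

-- Cliques are seen through the identifiers of their members, as the nodes see them.
module Selection {K : Set} (N : ℕ) (member : K → ℕ → Bool) (cliques : List K) where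

  mutual
    chosen : ℕ → K → List ℕ
    chosen zero    C = []
    chosen (suc j) C = addPick N (active j) (member C) (chosen j C)

    active : ℕ → ℕ → Bool
    active zero    x = true
    active (suc j) x = any (λ C → picks N (active j) (member C) (chosen j C) x) cliques

  module Round (j : ℕ) (C : K) = SelectionRule N (active j) (member C) (chosen j C)

  PickedAt : ℕ → K → ℕ → Set
  PickedAt j C x = Round.pick j C ≡ just x

  length-chosen : ∀ j C → length (chosen j C) ≤ j
  length-chosen zero    C = z≤n
  length-chosen (suc j) C = ≤-trans (Round.length-addPick j C) (s≤s (length-chosen j C))

  active-suc⁻ : ∀ j x → T (active (suc j) x) → ∃ λ C → C ∈ᴸ cliques × PickedAt j C x
  active-suc⁻ j x h with find (any⁻ _ cliques h)
  ... | C , C∈ , picks-x = C , C∈ , Round.picks⇒pick j C picks-x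

  active-suc⁺ : ∀ j {C x} → C ∈ᴸ cliques → PickedAt j C x → T (active (suc j) x)
  active-suc⁺ j {C} C∈ picked = any⁺ _ (lose C∈ (Round.pick⇒picks j C picked))

record NodeState : Set where
  field
    idBound rounds myId round : ℕ
    -- for each clique of the node: its membership test and the identifiers chosen in it
    cliqueStates : List ((ℕ → Bool) × List ℕ)
    isActive : Bool
open NodeState

decode : Maybe Msg → Bool
decode (just (b ∷ _)) = b
decode _              = false

advanceWith : NodeState → (ℕ → Bool) → NodeState
advanceWith s heard = record s
  { round        = suc (round s)
  ; cliqueStates = map (λ (m , ch) → m , addPick (idBound s) heard m ch) (cliqueStates s)
  ; isActive     = any (λ (m , ch) → picks (idBound s) heard m ch (myId s)) (cliqueStates s)
  }

heardFrom : NodeState → (ℕ → Maybe Msg) → ℕ → Bool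
heardFrom s inbox x = if x ≡ᵇ myId s then isActive s else decode (inbox x)

cliqueAlgorithm : ℕ → Algorithm
cliqueAlgorithm k = record
  { State  = NodeState
  ; init   = λ n D i _ cs → record
      { idBound = suc n ^ k ; rounds = D ; myId = i ; round = 0
      ; cliqueStates = map (_, []) cs ; isActive = true }
  ; send   = λ s _ → just (isActive s ∷ [])
  ; trans  = λ s inbox → if round s <ᵇ rounds s then advanceWith s (heardFrom s inbox) else s
  ; output = λ s → just (all (λ (_ , ch) → myId s ∈ᵇ ch) (cliqueStates s))
  }

messages-bounded : ∀ k n s x → MsgBounded 1 n (send (cliqueAlgorithm k) s x)
messages-bounded k n s x _ refl = s≤s z≤n

module _ (k : ℕ) (s : NodeState) (inbox : ℕ → Maybe Msg) where

  trans-active : T (round s <ᵇ rounds s) → trans (cliqueAlgorithm k) s inbox ≡ advanceWith s (heardFrom s inbox)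
  trans-active h with round s <ᵇ rounds s
  ... | true = refl

  trans-halted : ¬ T (round s <ᵇ rounds s) → trans (cliqueAlgorithm k) s inbox ≡ s
  trans-halted h with round s <ᵇ rounds s
  ... | true  = ⊥-elim (h tt)
  ... | false = refl

module CliqueSelection (k : ℕ) {n} (G : Graph n) (Q : List (Subset n)) (ids : Fin n → ℕ)
  (ids-injective : Injective _≡_ _≡_ ids) (ids<N : ∀ v → ids v < suc n ^ k)
  (cover : IsCliqueEdgeCover G Q) where

  A : Algorithm
  A = cliqueAlgorithm k

  N D : ℕ
  N = suc n ^ k
  D = diversity Q

  open Run A G Q ids
  open Selection N idOf Q

  idOf⁻ : ∀ C {x} → T (idOf C x) → ∃ λ u → u ∈ C × ids u ≡ x
  idOf⁻ C h with anyFin⁻ _ h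
  ... | u , hu with to (T-∧ {lookup C u}) hu
  ...   | u∈C , same = u , T-lookup⇒∈ u∈C , ≡ᵇ⇒≡ _ _ same

  ∈⇒idOf : ∀ {C u} → u ∈ C → T (idOf C (ids u))
  ∈⇒idOf {C} {u} u∈C = anyFin⁺ _ u (from T-∧ (∈⇒T-lookup u∈C , ≡⇒≡ᵇ (ids u) (ids u) refl))

  idOf⇒∈ : ∀ {C u} → T (idOf C (ids u)) → u ∈ C
  idOf⇒∈ {C} h with idOf⁻ C h
  ... | w , w∈C , same = subst (_∈ C) (ids-injective same) w∈C

  ∈-cliquesOf⁺ : ∀ {C u} → C ∈ᴸ Q → u ∈ C → C ∈ᴸ cliquesOf Q u
  ∈-cliquesOf⁺ {u = u} C∈Q u∈C = ∈-filter⁺ (T? ∘ λ C → lookup C u) C∈Q (∈⇒T-lookup u∈C)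

  ∈-cliquesOf⁻ : ∀ {C u} → C ∈ᴸ cliquesOf Q u → C ∈ᴸ Q × u ∈ C
  ∈-cliquesOf⁻ {u = u} C∈ with ∈-filter⁻ (T? ∘ λ C → lookup C u) C∈
  ... | C∈Q , u∈C = C∈Q , T-lookup⇒∈ u∈C

  length-cliquesOf≤D : ∀ u → length (cliquesOf Q u) ≤ D
  length-cliquesOf≤D = f≤maxFin (length ∘ cliquesOf Q)

  isClique : ∀ {C} → C ∈ᴸ Q → IsClique G C
  isClique = All.lookup (proj₁ cover)

  chosenAt : ℕ → Fin n → Subset n → Bool
  chosenAt j u C = ids u ∈ᵇ chosen j C

  allChosen : ℕ → Fin n → Bool
  allChosen j u = all (chosenAt j u) (cliquesOf Q u)

  P : Subset n
  P = tabulate (allChosen D)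

  chosenAt-suc : ∀ j u C → T (chosenAt j u C) → T (chosenAt (suc j) u C)
  chosenAt-suc j u C = Round.∈-addPick j C {ids u}

  allChosen⇒chosenAt : ∀ {j u C} → T (allChosen j u) → C ∈ᴸ Q → u ∈ C → T (chosenAt j u C)
  allChosen⇒chosenAt {j} {u} done C∈Q u∈C = All.lookup (all⁺ (chosenAt j u) (cliquesOf Q u) done) (∈-cliquesOf⁺ C∈Q u∈C)

  allChosen-suc : ∀ j u → T (allChosen j u) → T (allChosen (suc j) u)
  allChosen-suc j u done =
    all⁻ (chosenAt (suc j) u) (All.map (λ {C} → chosenAt-suc j u C) (all⁺ (chosenAt j u) (cliquesOf Q u) done))

  chosenCount : ℕ → Fin n → ℕ
  chosenCount j u = length (filterᵇ (chosenAt j u) (cliquesOf Q u))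

  active⇒j≤chosenCount : ∀ j u → T (active j (ids u)) → j ≤ chosenCount j u
  active⇒j≤chosenCount zero    u _      = z≤n
  active⇒j≤chosenCount (suc j) u active with active-suc⁻ j (ids u) active
  ... | C , C∈Q , picked with Round.pick-sound j C picked
  ...   | u∈C , fresh , wasActive =
    ≤-<-trans (active⇒j≤chosenCount j u wasActive)
      (length-filterᵇ-< {f = chosenAt j u} {g = chosenAt (suc j) u}
        (chosenAt-suc j u) (∈-cliquesOf⁺ C∈Q (idOf⇒∈ u∈C)) fresh (Round.pick⇒∈addPick j C picked))

  active⇒allChosen : ∀ u → T (active D (ids u)) → T (allChosen D u)
  active⇒allChosen u active =
    length≤length-filterᵇ⇒all _ (cliquesOf Q u) (≤-trans (length-cliquesOf≤D u) (active⇒j≤chosenCount D u active))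

  activation-spreads : ∀ j x → T (active j (ids x)) → ¬ T (allChosen j x) →
                       ∃ λ w → (∃ λ C → C ∈ᴸ Q × x ∈ C × w ∈ C) × T (active (suc j) (ids w))
  activation-spreads j x active ¬done with find (¬All⇒Any¬ (T? ∘ _) _ (¬done ∘ all⁻ _))
  ... | C , C∈ , fresh with ∈-cliquesOf⁻ C∈
  ...   | C∈Q , x∈C with Round.pick-complete j C (ids<N x) (∈⇒idOf x∈C) fresh active
  ...     | y , picked with idOf⁻ C (proj₁ (Round.pick-sound j C picked))
  ...       | w , w∈C , refl = w , (C , C∈Q , x∈C , w∈C) , active-suc⁺ j C∈Q picked

  walk-within-clique : ∀ {j v x w C} → C ∈ᴸ Q → x ∈ C → w ∈ C →
                       WithinDist G j v x → WithinDist G (suc j) v w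
  walk-within-clique {x = x} {w} C∈Q x∈C w∈C walk with x Fin.≟ w
  ... | yes refl = WithinDist-suc walk
  ... | no x≢w   = WithinDist-snoc walk (isClique C∈Q x w x∈C w∈C x≢w)

  active-or-allChosen-within : ∀ j v → ∃ λ x → WithinDist G j v x × (T (active j (ids x)) ⊎ T (allChosen j x))
  active-or-allChosen-within zero v = v , here , inj₁ tt
  active-or-allChosen-within (suc j) v with active-or-allChosen-within j v
  ... | x , walk , inj₂ done = x , WithinDist-suc walk , inj₂ (allChosen-suc j x done)
  ... | x , walk , inj₁ active with T? (allChosen j x)
  ...   | yes done = x , WithinDist-suc walk , inj₂ (allChosen-suc j x done)
  ...   | no ¬done with activation-spreads j x active ¬done
  ...     | w , (C , C∈Q , x∈C , w∈C) , active′ = w , walk-within-clique C∈Q x∈C w∈C walk , inj₁ active′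

  dominating : ∀ v → ∃ λ p → p ∈ P × WithinDist G D v p
  dominating v with active-or-allChosen-within D v
  ... | x , walk , status = x , ∈-tabulate⁺ (allChosen D) (Sum.[ active⇒allChosen x , id ] status) , walk

  ∣P∩C∣≤D : ∀ C → C ∈ᴸ Q → ∣ P ∩ C ∣ ≤ D
  ∣P∩C∣≤D C C∈Q = begin
    ∣ P ∩ C ∣                               ≤⟨ p⊆q⇒∣p∣≤∣q∣ P∩C⊆chosen ⟩
    ∣ tabulate (λ u → ids u ∈ᵇ chosen D C) ∣ ≤⟨ ∣preimage∣≤length ids-injective (chosen D C) ⟩
    length (chosen D C)                     ≤⟨ length-chosen D C ⟩
    D                                       ∎
    where
    open ≤-Reasoning
    P∩C⊆chosen : P ∩ C ⊆ tabulate (λ u → ids u ∈ᵇ chosen D C)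
    P∩C⊆chosen u∈ with x∈p∩q⁻ P C u∈
    ... | u∈P , u∈C = ∈-tabulate⁺ (λ u → chosenAt D u C)
                        (allChosen⇒chosenAt {D} (∈-tabulate⁻ (allChosen D) u∈P) C∈Q u∈C)

  ∣P∩nbhd∣≤D*D : ∀ v → ∣ P ∩ nbhd G v ∣ ≤ D * D
  ∣P∩nbhd∣≤D*D v = begin
    ∣ P ∩ nbhd G v ∣                    ≤⟨ p⊆q⇒∣p∣≤∣q∣ P∩nbhd⊆ ⟩
    ∣ ⋃ (map (P ∩_) (cliquesOf Q v)) ∣ ≤⟨ ∣⋃-map∣≤ (P ∩_) (cliquesOf Q v) (λ C∈ → ∣P∩C∣≤D _ (proj₁ (∈-cliquesOf⁻ C∈))) ⟩
    length (cliquesOf Q v) * D         ≤⟨ *-monoˡ-≤ D (length-cliquesOf≤D v) ⟩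
    D * D                              ∎
    where
    open ≤-Reasoning
    P∩nbhd⊆ : P ∩ nbhd G v ⊆ ⋃ (map (P ∩_) (cliquesOf Q v))
    P∩nbhd⊆ {u} u∈ with x∈p∩q⁻ P (nbhd G v) u∈
    ... | u∈P , u∈N with find (proj₂ (proj₂ cover) v u (to T-≡ (∈-tabulate⁻ (adj G v) u∈N)))
    ...   | C , C∈Q , v∈C , u∈C = ∈⋃-map⁺ (P ∩_) (∈-cliquesOf⁺ C∈Q v∈C) (x∈p∩q⁺ (u∈P , u∈C))

  snapshot : ℕ → Fin n → NodeState
  snapshot j v = record
    { idBound = N ; rounds = D ; myId = ids v ; round = j
    ; cliqueStates = map (λ C → idOf C , chosen j C) (cliquesOf Q v)
    ; isActive = active j (ids v) }

  run-zero : ∀ v → run 0 v ≡ snapshot 0 v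
  run-zero v = cong (λ cs → record (snapshot 0 v) { cliqueStates = cs }) (≡-sym (map-∘ (cliquesOf Q v)))

  advanceWith-snapshot : ∀ j v (heard : ℕ → Bool) →
    (∀ {C} → C ∈ᴸ cliquesOf Q v → ∀ x → T (idOf C x) → heard x ≡ active j x) →
    advanceWith (snapshot j v) heard ≡ snapshot (suc j) v
  advanceWith-snapshot j v heard agrees =
    cong₂ (λ cs a → record (snapshot (suc j) v) { cliqueStates = cs ; isActive = a }) states activity
    where
    open ≡-Reasoning
    L = cliquesOf Q v
    samePick : All (λ C → pick N heard (idOf C) (chosen j C) ≡ Round.pick j C) L
    samePick = All.tabulate λ {C} C∈ → pick-cong N (chosen j C) (agrees C∈)
    states : map (λ (m , ch) → m , addPick N heard m ch) (map (λ C → idOf C , chosen j C) L)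
           ≡ map (λ C → idOf C , chosen (suc j) C) L
    states = ≡-trans (≡-sym (map-∘ L))
      (map-cong-local (All.map (λ {C} → cong (λ p → idOf C , maybe (_∷ chosen j C) (chosen j C) p)) samePick))
    activity : any (λ (m , ch) → picks N heard m ch (ids v)) (map (λ C → idOf C , chosen j C) L)
             ≡ active (suc j) (ids v)
    activity = begin
      or (map _ (map (λ C → idOf C , chosen j C) L))
        ≡⟨ cong or (≡-sym (map-∘ L)) ⟩
      any (λ C → picks N heard (idOf C) (chosen j C) (ids v)) L
        ≡⟨ cong or (map-cong-local (All.map (cong (maybe (_≡ᵇ ids v) false)) samePick)) ⟩
      any (λ C → Round.picks j C (ids v)) L
        ≡⟨ any-filterᵇ (λ C h → ∈⇒T-lookup {p = C} (idOf⇒∈ (proj₁ (Round.pick-sound j C (Round.picks⇒pick j C h))))) Q ⟩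
      active (suc j) (ids v) ∎

  inbox : ℕ → Fin n → ℕ → Maybe Msg
  inbox t v x = maybe (λ u → send A (run t u) (ids v)) nothing (findFin (λ u → adj G u v ∧ (ids u ≡ᵇ x)))

  decode-inbox : ∀ t {v u} → adj G v u ≡ true → decode (inbox t v (ids u)) ≡ isActive (run t u)
  decode-inbox t {v} {u} vu with findFin-complete (λ w → adj G w v ∧ (ids w ≡ᵇ ids u)) u
                                   (from T-∧ (from T-≡ (≡-trans (sym G u v) vu) , ≡⇒≡ᵇ (ids u) (ids u) refl))
  ... | w , found rewrite found =
    cong (isActive ∘ run t) (ids-injective (≡ᵇ⇒≡ _ _ (proj₂ (to (T-∧ {adj G w v}) (findFin-sound _ found)))))

  heardFrom-snapshot : ∀ t → (∀ u → run t u ≡ snapshot t u) →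
    ∀ v {C} → C ∈ᴸ cliquesOf Q v → ∀ x → T (idOf C x) → heardFrom (snapshot t v) (inbox t v) x ≡ active t x
  heardFrom-snapshot t sim v {C} C∈ x x∈C with idOf⁻ C x∈C
  ... | u , u∈C , refl with ids u ≡ᵇ ids v in same
  ...   | true  = cong (active t) (≡-sym (≡ᵇ⇒≡ _ _ (from T-≡ same)))
  ...   | false = ≡-trans (decode-inbox t (isClique C∈Q v u v∈C u∈C v≢u)) (cong isActive (sim u))
    where
    C∈Q = proj₁ (∈-cliquesOf⁻ C∈)
    v∈C = proj₂ (∈-cliquesOf⁻ C∈)
    v≢u : v ≢ u
    v≢u refl = subst T same (≡⇒≡ᵇ (ids u) (ids u) refl)

  run-snapshot : ∀ t → t ≤ D → ∀ v → run t v ≡ snapshot t v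
  run-snapshot zero    _   v = run-zero v
  run-snapshot (suc t) t<D v = begin
    trans A (run t v) (inbox t v)
      ≡⟨ cong (λ s → trans A s (inbox t v)) (sim v) ⟩
    trans A (snapshot t v) (inbox t v)
      ≡⟨ trans-active k (snapshot t v) (inbox t v) (<⇒<ᵇ t<D) ⟩
    advanceWith (snapshot t v) (heardFrom (snapshot t v) (inbox t v))
      ≡⟨ advanceWith-snapshot t v _ (heardFrom-snapshot t sim v) ⟩
    snapshot (suc t) v ∎
    where
    open ≡-Reasoning
    sim = run-snapshot t (<⇒≤ t<D)

  run-halted : ∀ i v → run (i + D) v ≡ snapshot D v
  run-halted zero    v = run-snapshot D ≤-refl v
  run-halted (suc i) v = ≡-trans (cong (λ s → trans A s (inbox (i + D) v)) (run-halted i v))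
                                 (trans-halted k (snapshot D v) (inbox (i + D) v) (n≮n D ∘ <ᵇ⇒< D D))

  output-correct : ∀ t → D ≤ t → ∀ v → output A (run t v) ≡ just (lookup P v)
  output-correct t D≤t v = begin
    output A (run t v)           ≡⟨ cong (λ t → output A (run t v)) (≡-sym (m∸n+n≡m D≤t)) ⟩
    output A (run (t ∸ D + D) v) ≡⟨ cong (output A) (run-halted (t ∸ D) v) ⟩
    output A (snapshot D v)      ≡⟨ cong just (cong and (≡-sym (map-∘ (cliquesOf Q v)))) ⟩
    just (allChosen D v)         ≡⟨ cong just (≡-sym (lookup∘tabulate (allChosen D) v)) ⟩
    just (lookup P v)            ∎
    where open ≡-Reasoning

lemma19 : (k : ℕ) →
    Σ Algorithm λ A → Σ ℕ λ c → Σ ℕ λ B →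
      ∀ n (G : Graph n) (Q : List (Subset n)) (ids : Fin n → ℕ) →
      Injective _≡_ _≡_ ids → (∀ v → ids v < suc n ^ k) →
      IsCliqueEdgeCover G Q → Unique Q →
      let open Run A G Q ids in
        (∀ t u v → adj G u v ≡ true → MsgBounded B n (send A (run t u) (ids v)))
      × Σ (Subset n) λ P →
          (∀ t → c * diversity Q ≤ t → ∀ v → output A (run t v) ≡ just (lookup P v))
        × (∀ C → C ∈ᴸ Q → ∣ P ∩ C ∣ ≤ diversity Q)
        × (∀ v → ∃ λ p → p ∈ P × WithinDist G (diversity Q) v p)
        × IsVertexKernel G (diversity Q * diversity Q) (diversity Q) P
lemma19 k = cliqueAlgorithm k , 1 , 1 , λ n G Q ids ids-injective ids<N cover _ →
  let open CliqueSelection k G Q ids ids-injective ids<N cover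
      open Run A G Q ids
  in
    (λ t u v _ → messages-bounded k n (run t u) (ids v))
  , P
  , (λ t D≤t → output-correct t (≤-trans (≤-reflexive (≡-sym (*-identityˡ D))) D≤t))
  , ∣P∩C∣≤D
  , dominating
  , (λ v _ → ∣P∩nbhd∣≤D*D v)
  , dominating
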